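{- Let $1\leq k\leq n$ be integers with $k>\frac{n-1}{2}$. For $1\leq k'\leq n'$ let $\hat{B}_{k',n'}=\{x\in[0,1]^{n'}: x_{i+1}+\cdots+x_{i+k'}\leq1\text{ for all }0\leq i\leq n'-k'\}$. Then \[ E^*(\hat{B}_{k,n},z)=E^*(\hat{B}_{k+1,n+1},z). \]
   Context: For a lattice polytope $P\subset\mathbb{R}^m$, $E(P,t)=\#(tP\cap\mathbb{Z}^m)$ for integers $t\geq0$ and $E^*(P,z)=(1-z)^{m+1}\sum_{t\geq0}E(P,t)z^t$ is its Ehrhart $h^*$-polynomial. -}

module Defs where

open import Data.Nat as ℕ using (ℕ; zero; suc; _∸_; _≤_; _≤?_)
open import Data.Nat.Combinatorics using (_C_)
open import Data.Integer as ℤ using (ℤ; +_)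
open import Data.List using (List; []; _∷_; map; concatMap; upTo; take; drop; length; filter)
open import Data.Nat.ListAction using (sum)
open import Data.List.Relation.Unary.All using (All; all?)
open import Data.Vec using (Vec; []; _∷_; toList)
open import Data.Product using (_×_)
open import Relation.Nullary using (Dec; yes; no)
open import Relation.Nullary.Decidable using (_×-dec_)

box : ℕ → (n : ℕ) → List (Vec ℕ n)
box t zero    = [] ∷ []
box t (suc n) = concatMap (λ a → map (a ∷_) (box t n)) (upTo (suc t))

-- x lies in t·B̂_{k,n}:  0 ≤ x_i ≤ t for all i, and
-- x_{i+1} + ... + x_{i+k} ≤ t for all 0 ≤ i ≤ n - k.
-- (Nonnegativity is automatic since x ∈ ℕ^n.)
InDilate : (k n t : ℕ) → Vec ℕ n → Set
InDilate k n t x =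
  All (_≤ t) (toList x) ×
  All (λ i → sum (take k (drop i (toList x))) ≤ t) (upTo (suc (n ∸ k)))

inDilate? : (k n t : ℕ) → (x : Vec ℕ n) → Dec (InDilate k n t x)
inDilate? k n t x =
  all? (λ a → a ≤? t) (toList x) ×-dec
  all? (λ i → sum (take k (drop i (toList x))) ≤? t) (upTo (suc (n ∸ k)))

-- Ehrhart function E(B̂_{k,n}, t) = #(t B̂_{k,n} ∩ ℤ^n).
-- Any integer point of t B̂_{k,n} has coordinates in {0,...,t}, so it lies in box t n.
ehrhartB : (k n t : ℕ) → ℕ
ehrhartB k n t = length (filter (inDilate? k n t) (box t n))

sgn : ℕ → ℤ
sgn zero    = ℤ.+ 1
sgn (suc j) = ℤ.- sgn j

-- Σ_{j=0}^{J} (-1)^j C(m+1, j) E(t - j), with E(negative) = 0.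
hstarSum : (m : ℕ) → (ℕ → ℕ) → (t J : ℕ) → ℤ
hstarSum m E t zero    = + (E t)
hstarSum m E t (suc J) with suc J ≤? t
... | yes _ = hstarSum m E t J ℤ.+ (sgn (suc J) ℤ.* (+ ((suc m C suc J) ℕ.* E (t ∸ suc J))))
... | no  _ = hstarSum m E t J

-- Coefficient of z^t in E*(P,z) = (1-z)^{m+1} Σ_{s≥0} E(P,s) z^s,
-- for P ⊂ ℝ^m with Ehrhart function E. Terms with j > m+1 vanish (binomial is 0).
hstarCoeff : (m : ℕ) → (E : ℕ → ℕ) → ℕ → ℤ
hstarCoeff m E t = hstarSum m E t (suc m)

module Submission where

-- Write E(t) = #(t·B̂_{k,n} ∩ ℤⁿ), E⁺(t) = #(t·B̂_{k+1,n+1} ∩ ℤⁿ⁺¹) and p = n - k.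
--
-- (1) Counting.  E⁺(t) = Σ_{c=0}^{t} E(t - c).  Split a point of {0,…,t}ⁿ⁺¹ as
--     u ++ c ∷ v with |u| = p and |v| = k.  A window of k+1 consecutive
--     coordinates starts at some i ≤ p, so as p ≤ k it contains position p,
--     i.e. the coordinate c, and deleting c leaves the window of length k at i
--     in u ++ v.  The windows of u ++ v at 0 and at p cover all of u ++ v, so
--     its coordinates are bounded as well.  Hence
--     u ++ c ∷ v ∈ t·B̂_{k+1,n+1}  iff  c ≤ t and u ++ v ∈ (t-c)·B̂_{k,n}.
-- (2) Algebra.  By (1), Σ E⁺(t) zᵗ = (Σ E(t) zᵗ)/(1 - z), so multiplying by
--     (1-z)^{n+2} gives the claim.  On coefficients: the h*-coefficient is the
--     convolution of the coefficients of (1-z)^{m+1} with E, Pascal's rule makes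
--     (1-z)^{m+2} a difference operator applied to (1-z)^{m+1}, and differences
--     cancel partial sums.

open import Defs
open import Algebra.Bundles using (Monoid)
open import Data.Nat using (ℕ; zero; suc; _∸_; _≤_; _<_; z≤n; s≤s)
open import Function using (_∘_)

module RangeSum {c ℓ} (M : Monoid c ℓ) where
  open Monoid M
  open import Relation.Binary.Reasoning.Setoid setoid
  import Relation.Binary.PropositionalEquality as ≡
  open import Data.Nat using (_+_)
  open import Data.Nat.Properties using (+-suc; +-identityʳ; m≤m+n)

  Σ< : (ℕ → Carrier) → ℕ → Carrier
  Σ< f zero    = ε
  Σ< f (suc m) = f 0 ∙ Σ< (f ∘ suc) m

  Σ<-snoc : (f : ℕ → Carrier) (m : ℕ) → Σ< f (suc m) ≈ Σ< f m ∙ f m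
  Σ<-snoc f zero    = trans (identityʳ (f 0)) (sym (identityˡ (f 0)))
  Σ<-snoc f (suc m) = begin
    f 0 ∙ Σ< (f ∘ suc) (suc m)           ≈⟨ ∙-congˡ (Σ<-snoc (f ∘ suc) m) ⟩
    f 0 ∙ (Σ< (f ∘ suc) m ∙ f (suc m))   ≈⟨ sym (assoc _ _ _) ⟩
    Σ< f (suc m) ∙ f (suc m)             ∎

  Σ<-cong : {f g : ℕ → Carrier} (m : ℕ) → (∀ j → j < m → f j ≈ g j) → Σ< f m ≈ Σ< g m
  Σ<-cong zero    _  = refl
  Σ<-cong (suc m) eq = ∙-cong (eq 0 (s≤s z≤n)) (Σ<-cong m (λ j j<m → eq (suc j) (s≤s j<m)))

  Σ<-vanishing-tail : (f : ℕ → Carrier) (m d : ℕ) → (∀ j → m ≤ j → f j ≈ ε) →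
    Σ< f (m + d) ≈ Σ< f m
  Σ<-vanishing-tail f m zero    _      = reflexive (≡.cong (Σ< f) (+-identityʳ m))
  Σ<-vanishing-tail f m (suc d) vanish = begin
    Σ< f (m + suc d)          ≡⟨ ≡.cong (Σ< f) (+-suc m d) ⟩
    Σ< f (suc (m + d))        ≈⟨ Σ<-snoc f (m + d) ⟩
    Σ< f (m + d) ∙ f (m + d)  ≈⟨ ∙-cong (Σ<-vanishing-tail f m d vanish) (vanish (m + d) (m≤m+n m d)) ⟩
    Σ< f m ∙ ε                ≈⟨ identityʳ _ ⟩
    Σ< f m                    ∎

-- Part (1): the Ehrhart function of B̂_{k+1,n+1} is the sequence of partial
-- sums of that of B̂_{k,n}.
module Counting where
  open import Data.Nat using (_+_; _≤?_)
  open import Data.Nat.Properties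
  open import Algebra.Properties.CommutativeSemigroup +-commutativeSemigroup using (interchange; x∙yz≈y∙xz)
  open import Data.List using (List; []; _∷_; _++_; map; concatMap; upTo; applyUpTo; take; drop; length; filter)
  open import Data.List.Properties using (map-++; map-∘; map-cong; map-cong-local; map-concatMap; concatMap-cong; take-all; drop-all; length-drop)
  open import Data.List.Relation.Unary.All as All using (All; []; _∷_; all?)
  open import Data.List.Relation.Unary.All.Properties using (++⁺; ++⁻ˡ; ++⁻ʳ; map⁺; concat⁺; applyUpTo⁺₁; applyUpTo⁺₂; applyUpTo⁻)
  open import Data.Nat.ListAction using (sum)
  open import Data.Nat.ListAction.Properties using (sum-++)
  open import Data.Vec using (toList) renaming (_∷_ to _∷ᵥ_)
  open import Data.Product using (_×_; _,_; proj₁)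
  open import Function using (id; _⇔_; mk⇔; Equivalence)
  open import Relation.Nullary using (Dec; yes; no; ¬_; contradiction)
  open import Relation.Nullary.Decidable using (_×-dec_)
  open import Relation.Unary using (Pred; Decidable)
  open import Relation.Binary.PropositionalEquality
  open ≡-Reasoning
  open RangeSum +-0-monoid

  sumMap : {A : Set} → (A → ℕ) → List A → ℕ
  sumMap f xs = sum (map f xs)

  sumMap-++ : {A : Set} (f : A → ℕ) (xs ys : List A) → sumMap f (xs ++ ys) ≡ sumMap f xs + sumMap f ys
  sumMap-++ f xs ys = trans (cong sum (map-++ f xs ys)) (sum-++ (map f xs) (map f ys))

  sumMap-concatMap : {A B : Set} (f : B → ℕ) (g : A → List B) (xs : List A) →
    sumMap f (concatMap g xs) ≡ sumMap (λ x → sumMap f (g x)) xs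
  sumMap-concatMap f g []       = refl
  sumMap-concatMap f g (x ∷ xs) =
    trans (sumMap-++ f (g x) (concatMap g xs)) (cong (sumMap f (g x) +_) (sumMap-concatMap f g xs))

  sumMap-map : {A B : Set} (f : B → ℕ) (g : A → B) (xs : List A) → sumMap f (map g xs) ≡ sumMap (f ∘ g) xs
  sumMap-map f g xs = cong sum (sym (map-∘ xs))

  sumMap-cong : {A : Set} {f g : A → ℕ} → (∀ x → f x ≡ g x) → (xs : List A) → sumMap f xs ≡ sumMap g xs
  sumMap-cong eq xs = cong sum (map-cong eq xs)

  sumMap-cong-on : {A : Set} {P : A → Set} {f g : A → ℕ} {xs : List A} →
    All P xs → (∀ {x} → P x → f x ≡ g x) → sumMap f xs ≡ sumMap g xs
  sumMap-cong-on Pxs eq = cong sum (map-cong-local (All.map eq Pxs))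

  sumMap-zero : {A : Set} {f : A → ℕ} (xs : List A) → (∀ x → f x ≡ 0) → sumMap f xs ≡ 0
  sumMap-zero xs vanish = trans (sumMap-cong vanish xs) (sumMap-const-zero xs)
    where
    sumMap-const-zero : {A : Set} (xs : List A) → sumMap (λ _ → 0) xs ≡ 0
    sumMap-const-zero []       = refl
    sumMap-const-zero (_ ∷ xs) = sumMap-const-zero xs

  sumMap-+ : {A : Set} (f g : A → ℕ) (xs : List A) →
    sumMap (λ x → f x + g x) xs ≡ sumMap f xs + sumMap g xs
  sumMap-+ f g []       = refl
  sumMap-+ f g (x ∷ xs) =
    trans (cong (f x + g x +_) (sumMap-+ f g xs)) (interchange (f x) (g x) (sumMap f xs) (sumMap g xs))

  sumMap-swap : {A B : Set} (h : A → B → ℕ) (xs : List A) (ys : List B) →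
    sumMap (λ x → sumMap (h x) ys) xs ≡ sumMap (λ y → sumMap (λ x → h x y) xs) ys
  sumMap-swap h []       ys = sym (sumMap-zero ys (λ _ → refl))
  sumMap-swap h (x ∷ xs) ys = begin
    sumMap (h x) ys + sumMap (λ x′ → sumMap (h x′) ys) xs     ≡⟨ cong (sumMap (h x) ys +_) (sumMap-swap h xs ys) ⟩
    sumMap (h x) ys + sumMap (λ y → sumMap (λ x′ → h x′ y) xs) ys ≡⟨ sym (sumMap-+ (h x) _ ys) ⟩
    sumMap (λ y → sumMap (λ x′ → h x′ y) (x ∷ xs)) ys         ∎

  sumMap-applyUpTo : (f g : ℕ → ℕ) (m : ℕ) → sumMap f (applyUpTo g m) ≡ Σ< (f ∘ g) m
  sumMap-applyUpTo f g zero    = refl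
  sumMap-applyUpTo f g (suc m) = cong (f (g 0) +_) (sumMap-applyUpTo f (g ∘ suc) m)

  𝟙 : {P : Set} → Dec P → ℕ
  𝟙 (yes _) = 1
  𝟙 (no _)  = 0

  𝟙-no : {P : Set} (P? : Dec P) → ¬ P → 𝟙 P? ≡ 0
  𝟙-no (yes p) ¬p = contradiction p ¬p
  𝟙-no (no _)  _  = refl

  𝟙-⇔ : {P Q : Set} (P? : Dec P) (Q? : Dec Q) → P ⇔ Q → 𝟙 P? ≡ 𝟙 Q?
  𝟙-⇔ (yes _) (yes _) _   = refl
  𝟙-⇔ (no _)  (no _)  _   = refl
  𝟙-⇔ (yes p) (no ¬q) P⇔Q = contradiction (Equivalence.to P⇔Q p) ¬q
  𝟙-⇔ (no ¬p) (yes q) P⇔Q = contradiction (Equivalence.from P⇔Q q) ¬p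

  length-filter-𝟙 : {A : Set} {P : Pred A _} (P? : Decidable P) (xs : List A) →
    length (filter P? xs) ≡ sumMap (𝟙 ∘ P?) xs
  length-filter-𝟙 P? []       = refl
  length-filter-𝟙 P? (x ∷ xs) with P? x
  ... | yes _ = cong suc (length-filter-𝟙 P? xs)
  ... | no _  = length-filter-𝟙 P? xs

  cube : ℕ → ℕ → List (List ℕ)
  cube t zero    = [] ∷ []
  cube t (suc n) = concatMap (λ a → map (a ∷_) (cube t n)) (upTo (suc t))

  toList-box : (t n : ℕ) → map toList (box t n) ≡ cube t n
  toList-box t zero    = refl
  toList-box t (suc n) = begin
    map toList (concatMap (λ a → map (a ∷ᵥ_) (box t n)) (upTo (suc t)))
      ≡⟨ map-concatMap toList _ (upTo (suc t)) ⟩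
    concatMap (λ a → map toList (map (a ∷ᵥ_) (box t n))) (upTo (suc t))
      ≡⟨ concatMap-cong (λ a → trans (sym (map-∘ (box t n))) (map-∘ (box t n))) (upTo (suc t)) ⟩
    concatMap (λ a → map (a ∷_) (map toList (box t n))) (upTo (suc t))
      ≡⟨ cong (λ c → concatMap (λ a → map (a ∷_) c) (upTo (suc t))) (toList-box t n) ⟩
    cube t (suc n) ∎

  cube-length : (t n : ℕ) → All (λ l → length l ≡ n) (cube t n)
  cube-length t zero    = refl ∷ []
  cube-length t (suc n) =
    concat⁺ (map⁺ (applyUpTo⁺₂ id (suc t) (λ a → map⁺ (All.map (cong suc) (cube-length t n)))))

  cube-sum-suc : (f : List ℕ → ℕ) (t n : ℕ) →
    sumMap f (cube t (suc n)) ≡ sumMap (λ a → sumMap (λ l → f (a ∷ l)) (cube t n)) (upTo (suc t))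
  cube-sum-suc f t n = trans (sumMap-concatMap f (λ a → map (a ∷_) (cube t n)) (upTo (suc t)))
                             (sumMap-cong (λ a → sumMap-map f (a ∷_) (cube t n)) (upTo (suc t)))

  cube-++ : (f : List ℕ → ℕ) (t a b : ℕ) →
    sumMap f (cube t (a + b)) ≡ sumMap (λ u → sumMap (λ v → f (u ++ v)) (cube t b)) (cube t a)
  cube-++ f t zero    b = sym (+-identityʳ _)
  cube-++ f t (suc a) b = begin
    sumMap f (cube t (suc a + b))
      ≡⟨ cube-sum-suc f t (a + b) ⟩
    sumMap (λ c → sumMap (λ l → f (c ∷ l)) (cube t (a + b))) (upTo (suc t))
      ≡⟨ sumMap-cong (λ c → cube-++ (λ l → f (c ∷ l)) t a b) (upTo (suc t)) ⟩
    sumMap (λ c → sumMap (λ u → sumMap (λ v → f (c ∷ u ++ v)) (cube t b)) (cube t a)) (upTo (suc t))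
      ≡⟨ sym (cube-sum-suc (λ u → sumMap (λ v → f (u ++ v)) (cube t b)) t a) ⟩
    sumMap (λ u → sumMap (λ v → f (u ++ v)) (cube t b)) (cube t (suc a)) ∎

  cube-shrink : {s t : ℕ} → s ≤ t → {P : Pred (List ℕ) _} (P? : Decidable P) →
    (∀ l → P l → All (_≤ s) l) → (N : ℕ) →
    sumMap (𝟙 ∘ P?) (cube t N) ≡ sumMap (𝟙 ∘ P?) (cube s N)
  cube-shrink s≤t P? bounded zero    = refl
  cube-shrink {s} {t} s≤t P? bounded (suc N) = begin
    sumMap (𝟙 ∘ P?) (cube t (suc N))
      ≡⟨ cube-sum-suc (𝟙 ∘ P?) t N ⟩
    sumMap (λ a → sumMap (λ l → 𝟙 (P? (a ∷ l))) (cube t N)) (upTo (suc t))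
      ≡⟨ sumMap-cong (λ a → cube-shrink s≤t (P? ∘ (a ∷_)) (λ l → All.tail ∘ bounded (a ∷ l)) N) (upTo (suc t)) ⟩
    sumMap g (upTo (suc t))
      ≡⟨ sumMap-applyUpTo g id (suc t) ⟩
    Σ< g (suc t)
      ≡⟨ cong (Σ< g) (sym (m+[n∸m]≡n (s≤s s≤t))) ⟩
    Σ< g (suc s + (t ∸ s))
      ≡⟨ Σ<-vanishing-tail g (suc s) (t ∸ s) g-vanishes ⟩
    Σ< g (suc s)
      ≡⟨ sym (sumMap-applyUpTo g id (suc s)) ⟩
    sumMap g (upTo (suc s))
      ≡⟨ sym (cube-sum-suc (𝟙 ∘ P?) s N) ⟩
    sumMap (𝟙 ∘ P?) (cube s (suc N)) ∎
    where
    g : ℕ → ℕ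
    g a = sumMap (λ l → 𝟙 (P? (a ∷ l))) (cube s N)
    g-vanishes : ∀ a → s < a → g a ≡ 0
    g-vanishes a s<a = sumMap-zero (cube s N)
      (λ l → 𝟙-no (P? (a ∷ l)) (λ Pal → <⇒≱ s<a (All.head (bounded (a ∷ l) Pal))))

  window : ℕ → ℕ → List ℕ → ℕ
  window k i l = sum (take k (drop i l))

  Dilate : (k n t : ℕ) → List ℕ → Set
  Dilate k n t l = All (_≤ t) l × All (λ i → window k i l ≤ t) (upTo (suc (n ∸ k)))

  dilate? : (k n t : ℕ) (l : List ℕ) → Dec (Dilate k n t l)
  dilate? k n t l = all? (_≤? t) l ×-dec all? (λ i → window k i l ≤? t) (upTo (suc (n ∸ k)))

  ehrhartB-cube : (k n t : ℕ) → ehrhartB k n t ≡ sumMap (𝟙 ∘ dilate? k n t) (cube t n)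
  ehrhartB-cube k n t = begin
    length (filter (inDilate? k n t) (box t n))   ≡⟨ length-filter-𝟙 (inDilate? k n t) (box t n) ⟩
    sumMap (𝟙 ∘ dilate? k n t ∘ toList) (box t n) ≡⟨ sym (sumMap-map (𝟙 ∘ dilate? k n t) toList (box t n)) ⟩
    sumMap (𝟙 ∘ dilate? k n t) (map toList (box t n)) ≡⟨ cong (sumMap (𝟙 ∘ dilate? k n t)) (toList-box t n) ⟩
    sumMap (𝟙 ∘ dilate? k n t) (cube t n)         ∎

  drop-++ : (i : ℕ) (u w : List ℕ) → i ≤ length u → drop i (u ++ w) ≡ drop i u ++ w
  drop-++ zero    u       w _         = refl
  drop-++ (suc i) (_ ∷ u) w (s≤s i≤u) = drop-++ i u w i≤u

  take-insert : (k c : ℕ) (u v : List ℕ) → length u ≤ k →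
    sum (take (suc k) (u ++ c ∷ v)) ≡ c + sum (take k (u ++ v))
  take-insert k       c []      v _         = refl
  take-insert (suc k) c (x ∷ u) v (s≤s u≤k) =
    trans (cong (x +_) (take-insert k c u v u≤k)) (x∙yz≈y∙xz x c _)

  window-insert : (k i c : ℕ) (u v : List ℕ) → length u ≤ k → i ≤ length u →
    window (suc k) i (u ++ c ∷ v) ≡ c + window k i (u ++ v)
  window-insert k i c u v u≤k i≤u = begin
    sum (take (suc k) (drop i (u ++ c ∷ v))) ≡⟨ cong (sum ∘ take (suc k)) (drop-++ i u (c ∷ v) i≤u) ⟩
    sum (take (suc k) (drop i u ++ c ∷ v))   ≡⟨ take-insert k c (drop i u) v drop-i-u≤k ⟩
    c + sum (take k (drop i u ++ v))         ≡⟨ cong (λ w → c + sum (take k w)) (sym (drop-++ i u v i≤u)) ⟩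
    c + window k i (u ++ v)                  ∎
    where
    drop-i-u≤k : length (drop i u) ≤ k
    drop-i-u≤k = ≤-trans (≤-reflexive (length-drop i u)) (≤-trans (m∸n≤m (length u) i) u≤k)

  entries-≤-sum : {s : ℕ} (l : List ℕ) → sum l ≤ s → All (_≤ s) l
  entries-≤-sum []      _ = []
  entries-≤-sum (x ∷ l) x+l≤s = m+n≤o⇒m≤o x x+l≤s ∷ entries-≤-sum l (≤-trans (m≤n+m (sum l) x) x+l≤s)

  All-take-drop : {P : ℕ → Set} {a b : ℕ} (w : List ℕ) → b ≤ a →
    All P (take a w) → All P (drop b w) → All P w
  All-take-drop w       z≤n       _            Pdrop = Pdrop
  All-take-drop []      (s≤s _)   _            _     = []
  All-take-drop (x ∷ w) (s≤s b≤a) (Px ∷ Ptake) Pdrop = Px ∷ All-take-drop w b≤a Ptake Pdrop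

  module _ (k n t c : ℕ) (u v : List ℕ) (n∸k≤k : n ∸ k ≤ k)
           (|u|≡n∸k : length u ≡ n ∸ k) (|v|≡k : length v ≡ k) (c≤t : c ≤ t) where

    private
      p : ℕ
      p = n ∸ k

      window-insert′ : ∀ {i} → i < suc p → window (suc k) i (u ++ c ∷ v) ≡ c + window k i (u ++ v)
      window-insert′ {i} i<sp = window-insert k i c u v (subst (_≤ k) (sym |u|≡n∸k) n∸k≤k)
                                                         (subst (i ≤_) (sym |u|≡n∸k) (≤-pred i<sp))

      drop-p : drop p (u ++ v) ≡ v
      drop-p = trans (drop-++ p u v (≤-reflexive (sym |u|≡n∸k)))
                     (cong (_++ v) (drop-all p u (≤-reflexive |u|≡n∸k)))

    remove-middle : Dilate (suc k) (suc n) t (u ++ c ∷ v) → Dilate k n (t ∸ c) (u ++ v)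
    remove-middle (_ , windows⁺) = entries , applyUpTo⁺₁ id (suc p) window-bound
      where
      window-bound : ∀ {i} → i < suc p → window k i (u ++ v) ≤ t ∸ c
      window-bound i<sp = m+n≤o⇒m≤o∸n _
        (subst (_≤ t) (trans (window-insert′ i<sp) (+-comm c _)) (applyUpTo⁻ id (suc p) windows⁺ i<sp))
      last-window : sum v ≤ t ∸ c
      last-window = subst (λ w → sum w ≤ t ∸ c)
        (trans (cong (take k) drop-p) (take-all k v (≤-reflexive |v|≡k))) (window-bound ≤-refl)
      entries : All (_≤ t ∸ c) (u ++ v)
      entries = All-take-drop (u ++ v) n∸k≤k (entries-≤-sum _ (window-bound (s≤s z≤n)))
        (subst (All (_≤ t ∸ c)) (sym drop-p) (entries-≤-sum v last-window))

    insert-middle : Dilate k n (t ∸ c) (u ++ v) → Dilate (suc k) (suc n) t (u ++ c ∷ v)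
    insert-middle (entries , windows) = entries⁺ , applyUpTo⁺₁ id (suc p) window-bound
      where
      weaken : ∀ {x} → x ≤ t ∸ c → x ≤ t
      weaken x≤t∸c = ≤-trans x≤t∸c (m∸n≤m t c)
      entries⁺ : All (_≤ t) (u ++ c ∷ v)
      entries⁺ = ++⁺ (All.map weaken (++⁻ˡ u entries)) (c≤t ∷ All.map weaken (++⁻ʳ u entries))
      window-bound : ∀ {i} → i < suc p → window (suc k) i (u ++ c ∷ v) ≤ t
      window-bound i<sp = subst (_≤ t) (sym (window-insert′ i<sp))
        (subst (c + _ ≤_) (m+[n∸m]≡n c≤t) (+-monoʳ-≤ c (applyUpTo⁻ id (suc p) windows i<sp)))

    insert-middle-⇔ : Dilate (suc k) (suc n) t (u ++ c ∷ v) ⇔ Dilate k n (t ∸ c) (u ++ v)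
    insert-middle-⇔ = mk⇔ remove-middle insert-middle

  partialSums : (ℕ → ℕ) → ℕ → ℕ
  partialSums E s = Σ< (λ c → E (s ∸ c)) (suc s)

  -- Sorting the points of t·B̂_{k+1,n+1} by their coordinate at position n - k:
  -- those with value c correspond to the points of (t-c)·B̂_{k,n} in {0..t}ⁿ.
  count-by-middle : (k n t : ℕ) → k ≤ n → n ∸ k ≤ k →
    sumMap (𝟙 ∘ dilate? (suc k) (suc n) t) (cube t (suc n))
      ≡ sumMap (λ c → sumMap (𝟙 ∘ dilate? k n (t ∸ c)) (cube t n)) (upTo (suc t))
  count-by-middle k n t k≤n n∸k≤k = begin
    sumMap F (cube t (suc n))
      ≡⟨ cong (sumMap F ∘ cube t) (sym (trans (+-suc p k) (cong suc p+k≡n))) ⟩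
    sumMap F (cube t (p + suc k))
      ≡⟨ cube-++ F t p (suc k) ⟩
    sumMap (λ u → sumMap (λ w → F (u ++ w)) (cube t (suc k))) (cube t p)
      ≡⟨ sumMap-cong (λ u → cube-sum-suc (F ∘ (u ++_)) t k) (cube t p) ⟩
    sumMap (λ u → sumMap (λ c → sumMap (λ v → F (u ++ c ∷ v)) (cube t k)) (upTo (suc t))) (cube t p)
      ≡⟨ sumMap-cong-on (cube-length t p) (λ |u| → sumMap-cong-on (applyUpTo⁺₁ id (suc t) id) (λ c<st →
           sumMap-cong-on (cube-length t k) (λ |v| →
             𝟙-⇔ _ _ (insert-middle-⇔ k n t _ _ _ n∸k≤k |u| |v| (≤-pred c<st))))) ⟩
    sumMap (λ u → sumMap (λ c → sumMap (λ v → G c (u ++ v)) (cube t k)) (upTo (suc t))) (cube t p)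
      ≡⟨ sumMap-swap (λ u c → sumMap (λ v → G c (u ++ v)) (cube t k)) (cube t p) (upTo (suc t)) ⟩
    sumMap (λ c → sumMap (λ u → sumMap (λ v → G c (u ++ v)) (cube t k)) (cube t p)) (upTo (suc t))
      ≡⟨ sumMap-cong (λ c → trans (sym (cube-++ (G c) t p k)) (cong (sumMap (G c) ∘ cube t) p+k≡n)) (upTo (suc t)) ⟩
    sumMap (λ c → sumMap (G c) (cube t n)) (upTo (suc t)) ∎
    where
    p = n ∸ k
    F = 𝟙 ∘ dilate? (suc k) (suc n) t
    G = λ c → 𝟙 ∘ dilate? k n (t ∸ c)
    p+k≡n : p + k ≡ n
    p+k≡n = m∸n+n≡m k≤n

  ehrhart-recurrence : (k n : ℕ) → k ≤ n → n ∸ k ≤ k →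
    (t : ℕ) → ehrhartB (suc k) (suc n) t ≡ partialSums (ehrhartB k n) t
  ehrhart-recurrence k n k≤n n∸k≤k t = begin
    ehrhartB (suc k) (suc n) t
      ≡⟨ ehrhartB-cube (suc k) (suc n) t ⟩
    sumMap (𝟙 ∘ dilate? (suc k) (suc n) t) (cube t (suc n))
      ≡⟨ count-by-middle k n t k≤n n∸k≤k ⟩
    sumMap (λ c → sumMap (𝟙 ∘ dilate? k n (t ∸ c)) (cube t n)) (upTo (suc t))
      ≡⟨ sumMap-cong (λ c → trans (cube-shrink (m∸n≤m t c) (dilate? k n (t ∸ c)) (λ _ → proj₁) n)
                                  (sym (ehrhartB-cube k n (t ∸ c)))) (upTo (suc t)) ⟩
    sumMap (λ c → ehrhartB k n (t ∸ c)) (upTo (suc t))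
      ≡⟨ sumMap-applyUpTo (λ c → ehrhartB k n (t ∸ c)) id (suc t) ⟩
    partialSums (ehrhartB k n) t ∎

-- Part (2): identities between h*-coefficients, convolutions and partial sums.
module Convolution where
  open import Data.Nat using (_≤?_) renaming (_+_ to _+ℕ_; _*_ to _*ℕ_)
  import Data.Nat.Properties as ℕ
  open import Data.Nat.Combinatorics using (_C_; k>n⇒nCk≡0; nCk+nC[k+1]≡[n+1]C[k+1])
  open import Data.Integer using (ℤ; +_; -_; _+_; _-_; _*_)
  open import Data.Integer.Properties using (+-0-monoid; +-identityʳ; *-identityˡ; +-assoc; +-comm; *-zeroʳ; *-assoc; pos-*; pos-+)
  open import Data.Integer.Tactic.RingSolver using (solve-∀)
  open import Data.Product using (_×_; _,_)
  open import Relation.Nullary using (yes; no; contradiction)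
  open import Relation.Binary.PropositionalEquality
  open ≡-Reasoning
  open RangeSum +-0-monoid
  open Counting using (partialSums)

  -- Coefficient of zʲ in (1 - z)^{m+1}.
  powCoeff : ℕ → ℕ → ℤ
  powCoeff m j = sgn j * + (suc m C j)

  -- Pascal's rule: (1-z)^{m+2} = (1-z)^{m+1} - z (1-z)^{m+1}.
  powCoeff-pascal : (m j : ℕ) → powCoeff (suc m) (suc j) ≡ powCoeff m (suc j) - powCoeff m j
  powCoeff-pascal m j = begin
    - sgn j * + (suc (suc m) C suc j)               ≡⟨ cong (λ x → - sgn j * + x) (sym (nCk+nC[k+1]≡[n+1]C[k+1] (suc m) j)) ⟩
    - sgn j * + ((suc m C j) +ℕ (suc m C suc j))     ≡⟨ cong (- sgn j *_) (pos-+ (suc m C j) _) ⟩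
    - sgn j * (+ (suc m C j) + + (suc m C suc j))   ≡⟨ distrib (sgn j) _ _ ⟩
    - sgn j * + (suc m C suc j) - sgn j * + (suc m C j) ∎
    where
    distrib : ∀ s x y → - s * (x + y) ≡ - s * y - s * x
    distrib = solve-∀

  _⋆_ : (ℕ → ℤ) → (ℕ → ℤ) → ℕ → ℤ
  (a ⋆ b) t = Σ< (λ j → a j * b (t ∸ j)) (suc t)

  Σ<-sub : (f g : ℕ → ℤ) (m : ℕ) → Σ< (λ j → f j - g j) m ≡ Σ< f m - Σ< g m
  Σ<-sub f g zero    = refl
  Σ<-sub f g (suc m) = begin
    f 0 - g 0 + Σ< (λ j → f (suc j) - g (suc j)) m ≡⟨ cong (_+_ (f 0 - g 0)) (Σ<-sub (f ∘ suc) (g ∘ suc) m) ⟩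
    f 0 - g 0 + (Σ< (f ∘ suc) m - Σ< (g ∘ suc) m)  ≡⟨ regroup (f 0) (g 0) _ _ ⟩
    f 0 + Σ< (f ∘ suc) m - (g 0 + Σ< (g ∘ suc) m)  ∎
    where
    regroup : ∀ w x y z → w - x + (y - z) ≡ w + y - (x + z)
    regroup = solve-∀

  hstarTerm : ℕ → (ℕ → ℕ) → ℕ → ℕ → ℤ
  hstarTerm m E t j with j ≤? t
  ... | yes _ = sgn j * + ((suc m C j) *ℕ E (t ∸ j))
  ... | no  _ = + 0

  hstarSum-step : (m : ℕ) (E : ℕ → ℕ) (t J : ℕ) →
    hstarSum m E t (suc J) ≡ hstarSum m E t J + hstarTerm m E t (suc J)
  hstarSum-step m E t J with suc J ≤? t
  ... | yes _ = refl
  ... | no  _ = sym (+-identityʳ _)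

  hstarSum-Σ< : (m : ℕ) (E : ℕ → ℕ) (t J : ℕ) → hstarSum m E t J ≡ Σ< (hstarTerm m E t) (suc J)
  hstarSum-Σ< m E t zero    = sym (trans (+-identityʳ _) (trans (*-identityˡ _) (cong +_ (ℕ.+-identityʳ (E t)))))
  hstarSum-Σ< m E t (suc J) = begin
    hstarSum m E t (suc J)                                   ≡⟨ hstarSum-step m E t J ⟩
    hstarSum m E t J + hstarTerm m E t (suc J)               ≡⟨ cong (_+ hstarTerm m E t (suc J)) (hstarSum-Σ< m E t J) ⟩
    Σ< (hstarTerm m E t) (suc J) + hstarTerm m E t (suc J)   ≡⟨ sym (Σ<-snoc (hstarTerm m E t) (suc J)) ⟩
    Σ< (hstarTerm m E t) (suc (suc J))                       ∎

  hstarCoeff-⋆ : (m : ℕ) (E : ℕ → ℕ) (t : ℕ) → hstarCoeff m E t ≡ (powCoeff m ⋆ (+_ ∘ E)) t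
  hstarCoeff-⋆ m E t = begin
    hstarSum m E t (suc m)          ≡⟨ hstarSum-Σ< m E t (suc m) ⟩
    Σ< T (suc (suc m))              ≡⟨ sym (Σ<-vanishing-tail T (suc (suc m)) t beyond-degree) ⟩
    Σ< T (suc (suc m) +ℕ t)         ≡⟨ cong (Σ< T ∘ suc) (ℕ.+-comm (suc m) t) ⟩
    Σ< T (suc t +ℕ suc m)           ≡⟨ Σ<-vanishing-tail T (suc t) (suc m) beyond-t ⟩
    Σ< T (suc t)                    ≡⟨ Σ<-cong (suc t) within-t ⟩
    (powCoeff m ⋆ (+_ ∘ E)) t       ∎
    where
    T = hstarTerm m E t
    beyond-degree : ∀ j → suc (suc m) ≤ j → T j ≡ + 0
    beyond-degree j m+1<j with j ≤? t
    ... | yes _ = trans (cong (λ x → sgn j * + (x *ℕ E (t ∸ j))) (k>n⇒nCk≡0 m+1<j)) (*-zeroʳ (sgn j))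
    ... | no  _ = refl
    beyond-t : ∀ j → suc t ≤ j → T j ≡ + 0
    beyond-t j t<j with j ≤? t
    ... | yes j≤t = contradiction j≤t (ℕ.<⇒≱ t<j)
    ... | no  _   = refl
    within-t : ∀ j → j < suc t → T j ≡ powCoeff m j * + E (t ∸ j)
    within-t j (s≤s j≤t) with j ≤? t
    ... | yes _   = trans (cong (sgn j *_) (pos-* (suc m C j) (E (t ∸ j)))) (sym (*-assoc (sgn j) _ _))
    ... | no j≰t  = contradiction j≤t j≰t

  ⋆-difference : (a a′ b : ℕ → ℤ) → a′ 0 ≡ a 0 → (∀ j → a′ (suc j) ≡ a (suc j) - a j) →
    (t : ℕ) → (a′ ⋆ b) (suc t) ≡ (a ⋆ b) (suc t) - (a ⋆ b) t
  ⋆-difference a a′ b a′₀ a′ₛ t = begin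
    a′ 0 * b (suc t) + Σ< (λ j → a′ (suc j) * b (t ∸ j)) (suc t)
      ≡⟨ cong₂ _+_ (cong (_* b (suc t)) a′₀) (Σ<-cong (suc t) (λ j _ → trans (cong (_* b (t ∸ j)) (a′ₛ j)) (distrib (a (suc j)) (a j) (b (t ∸ j))))) ⟩
    a 0 * b (suc t) + Σ< (λ j → a (suc j) * b (t ∸ j) - a j * b (t ∸ j)) (suc t)
      ≡⟨ cong (_+_ (a 0 * b (suc t))) (Σ<-sub (λ j → a (suc j) * b (t ∸ j)) (λ j → a j * b (t ∸ j)) (suc t)) ⟩
    a 0 * b (suc t) + (Σ< (λ j → a (suc j) * b (t ∸ j)) (suc t) - (a ⋆ b) t)
      ≡⟨ sym (+-assoc (a 0 * b (suc t)) _ _) ⟩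
    (a ⋆ b) (suc t) - (a ⋆ b) t ∎
    where
    distrib : ∀ x y z → (x - y) * z ≡ x * z - y * z
    distrib = solve-∀

  PartialSumsOf : (ℕ → ℤ) → (ℕ → ℤ) → Set
  PartialSumsOf b b′ = b′ 0 ≡ b 0 × (∀ s → b′ (suc s) ≡ b′ s + b (suc s))

  ⋆-partialSums : (b b′ : ℕ → ℤ) → PartialSumsOf b b′ →
    (t : ℕ) (a : ℕ → ℤ) → (a ⋆ b′) (suc t) ≡ (a ⋆ b′) t + (a ⋆ b) (suc t)
  ⋆-partialSums b b′ (b′₀ , b′ₛ) zero a = begin
    a 0 * b′ 1 + (a 1 * b′ 0 + + 0)            ≡⟨ cong₂ (λ x y → a 0 * x + (a 1 * y + + 0)) (b′ₛ 0) b′₀ ⟩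
    a 0 * (b′ 0 + b 1) + (a 1 * b 0 + + 0)     ≡⟨ regroup (a 0) (a 1) (b′ 0) (b 0) (b 1) ⟩
    a 0 * b′ 0 + + 0 + (a 0 * b 1 + (a 1 * b 0 + + 0)) ∎
    where
    regroup : ∀ a₀ a₁ x b₀ b₁ → a₀ * (x + b₁) + (a₁ * b₀ + + 0) ≡ a₀ * x + + 0 + (a₀ * b₁ + (a₁ * b₀ + + 0))
    regroup = solve-∀
  ⋆-partialSums b b′ (b′₀ , b′ₛ) (suc t) a = begin
    a 0 * b′ (suc (suc t)) + ((a ∘ suc) ⋆ b′) (suc t)
      ≡⟨ cong₂ _+_ (cong (a 0 *_) (b′ₛ (suc t))) (⋆-partialSums b b′ (b′₀ , b′ₛ) t (a ∘ suc)) ⟩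
    a 0 * (b′ (suc t) + b (suc (suc t))) + (((a ∘ suc) ⋆ b′) t + ((a ∘ suc) ⋆ b) (suc t))
      ≡⟨ regroup (a 0) (b′ (suc t)) (b (suc (suc t))) _ _ ⟩
    (a 0 * b′ (suc t) + ((a ∘ suc) ⋆ b′) t) + (a 0 * b (suc (suc t)) + ((a ∘ suc) ⋆ b) (suc t)) ∎
    where
    regroup : ∀ x y z w v → x * (y + z) + (w + v) ≡ (x * y + w) + (x * z + v)
    regroup = solve-∀

  ⋆-cancel : (m : ℕ) (b b′ : ℕ → ℤ) → PartialSumsOf b b′ →
    (t : ℕ) → (powCoeff (suc m) ⋆ b′) t ≡ (powCoeff m ⋆ b) t
  ⋆-cancel m b b′ (b′₀ , _) zero = cong (λ x → powCoeff m 0 * x + + 0) b′₀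
  ⋆-cancel m b b′ b′-sums (suc t) = begin
    (powCoeff (suc m) ⋆ b′) (suc t)                      ≡⟨ ⋆-difference (powCoeff m) (powCoeff (suc m)) b′ refl (powCoeff-pascal m) t ⟩
    (powCoeff m ⋆ b′) (suc t) - (powCoeff m ⋆ b′) t      ≡⟨ cong (_- (powCoeff m ⋆ b′) t) (⋆-partialSums b b′ b′-sums t (powCoeff m)) ⟩
    (powCoeff m ⋆ b′) t + (powCoeff m ⋆ b) (suc t) - (powCoeff m ⋆ b′) t ≡⟨ cancel ((powCoeff m ⋆ b′) t) _ ⟩
    (powCoeff m ⋆ b) (suc t)                             ∎
    where
    cancel : ∀ x y → x + y - x ≡ y
    cancel = solve-∀

  partialSums-of : (E F : ℕ → ℕ) → (∀ s → F s ≡ partialSums E s) → PartialSumsOf (+_ ∘ E) (+_ ∘ F)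
  partialSums-of E F F≡ΣE = cong +_ (trans (F≡ΣE 0) (ℕ.+-identityʳ (E 0))) , λ s → begin
    + F (suc s)                        ≡⟨ cong +_ (F≡ΣE (suc s)) ⟩
    + (E (suc s) +ℕ partialSums E s)   ≡⟨ pos-+ (E (suc s)) (partialSums E s) ⟩
    + E (suc s) + + partialSums E s    ≡⟨ +-comm (+ E (suc s)) (+ partialSums E s) ⟩
    + partialSums E s + + E (suc s)    ≡⟨ cong (λ x → + x + + E (suc s)) (sym (F≡ΣE s)) ⟩
    + F s + + E (suc s)                ∎

open import Data.Nat using (_+_; _*_)
open import Data.Nat.Properties using (+-identityʳ; m≤n+o⇒m∸n≤o)
open import Data.Integer using (+_)
open import Relation.Binary.PropositionalEquality using (_≡_; sym; cong; subst; module ≡-Reasoning)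
open Counting using (ehrhart-recurrence)
open Convolution using (powCoeff; _⋆_; PartialSumsOf; hstarCoeff-⋆; ⋆-cancel; partialSums-of)

lemma6p1 : (k n : ℕ) → 1 ≤ k → k ≤ n → n < suc (2 * k) →
    (t : ℕ) → hstarCoeff n (ehrhartB k n) t ≡ hstarCoeff (suc n) (ehrhartB (suc k) (suc n)) t
lemma6p1 k n _ k≤n (s≤s n≤2k) t = begin
  hstarCoeff n E t                   ≡⟨ hstarCoeff-⋆ n E t ⟩
  (powCoeff n ⋆ (+_ ∘ E)) t          ≡⟨ sym (⋆-cancel n (+_ ∘ E) (+_ ∘ E⁺) E⁺-partialSums t) ⟩
  (powCoeff (suc n) ⋆ (+_ ∘ E⁺)) t   ≡⟨ sym (hstarCoeff-⋆ (suc n) E⁺ t) ⟩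
  hstarCoeff (suc n) E⁺ t            ∎
  where
  open ≡-Reasoning
  E  = ehrhartB k n
  E⁺ = ehrhartB (suc k) (suc n)
  -- k > (n-1)/2 means n - k ≤ k
  n∸k≤k : n ∸ k ≤ k
  n∸k≤k = m≤n+o⇒m∸n≤o n k (subst (n ≤_) (cong (_+_ k) (+-identityʳ k)) n≤2k)
  E⁺-partialSums : PartialSumsOf (+_ ∘ E) (+_ ∘ E⁺)
  E⁺-partialSums = partialSums-of E E⁺ (ehrhart-recurrence k n k≤n n∸k≤k)
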